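{- Let $G=R(m;a,b,c)$ be a connected generalized rose window graph, let $H$ be the graph obtained from $G$ by removing all spokes of type $c$, and let $H_0$ be the connected component of $H$ containing $u_0$. Assume $\gcd(m,a,b)>1$. If $H_0$ has an alternating Hamilton cycle, then $G$ is hamiltonian.
   Context: For $m\ge3$ and $a,b,c\in\mathbb{Z}_m\setminus\{0\}$ with $a,b\ne m/2$, the generalized rose window graph $R(m;a,b,c)$ has vertices $u_i,v_i$ ($i\in\mathbb{Z}_m$) and edges $u_iu_{i+a}$ (outer edges), $v_iv_{i+b}$ (inner edges), $u_iv_i$ (spokes of type $0$) and $u_iv_{i+c}$ (spokes of type $c$), for $i\in\mathbb{Z}_m$. The component $H_0$ has vertex set $\{u_x,v_x : x\in\Lambda\}$ where $\Lambda$ is the subgroup of $\mathbb{Z}_m$ generated by $a$ and $b$, with edges $u_xu_{x+a}$, $v_xv_{x+b}$, $u_xv_x$. A Hamilton cycle of $H_0$ is alternating if every maximal subpath of it consisting of outer edges, and every maximal subpath consisting of inner edges, has exactly one edge (equivalently, it uses all spokes $u_xv_x$ of $H_0$). -}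

module Defs where

open import Data.Nat using (ℕ; zero; suc; _+_; _*_; _≤_; _<_; NonZero)
open import Data.Nat.DivMod using (_%_; m%n<n)
open import Data.Fin using (Fin; toℕ; fromℕ<)
open import Data.Integer as ℤ using (ℤ; +_)
open import Data.Integer.Divisibility as ℤDiv using ()
open import Data.Product using (Σ; _×_; _,_; ∃; ∃-syntax)
open import Data.Sum using (_⊎_)
open import Data.Unit using (⊤)
open import Relation.Binary.PropositionalEquality using (_≡_)
open import Relation.Nullary using (¬_)
open import Relation.Binary.Construct.Closure.ReflexiveTransitive using (Star)
open import Function.Definitions using (Injective)

_≡_[mod_] : ℕ → ℕ → ℕ → Set
x ≡ y [mod m ] = (+ m) ℤDiv.∣ ((+ x) ℤ.- (+ y))

Diff : (m d x y : ℕ) → Set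
Diff m d x y = (y ≡ x + d [mod m ]) ⊎ (x ≡ y + d [mod m ])

-- vertices: u_i = (U , i), v_i = (V , i), i ∈ ℤ_m ≅ Fin m
data Side : Set where
  U V : Side

Vertex : ℕ → Set
Vertex m = Side × Fin m

module _ (m a b c : ℕ) where
  data OuterE : Vertex m → Vertex m → Set where
    outerE : ∀ {i j} → Diff m a (toℕ i) (toℕ j) → OuterE (U , i) (U , j)

  data InnerE : Vertex m → Vertex m → Set where
    innerE : ∀ {i j} → Diff m b (toℕ i) (toℕ j) → InnerE (V , i) (V , j)

  data Spoke0E : Vertex m → Vertex m → Set where
    spoke0 : ∀ {i} → Spoke0E (U , i) (V , i)
    spoke0' : ∀ {i} → Spoke0E (V , i) (U , i)

  data SpokeCE : Vertex m → Vertex m → Set where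
    spokeC : ∀ {i j} → toℕ j ≡ toℕ i + c [mod m ] → SpokeCE (U , i) (V , j)
    spokeC' : ∀ {i j} → toℕ j ≡ toℕ i + c [mod m ] → SpokeCE (V , j) (U , i)

  RAdj : Vertex m → Vertex m → Set
  RAdj x y = OuterE x y ⊎ InnerE x y ⊎ Spoke0E x y ⊎ SpokeCE x y

-- adjacency in H_0 (no spokes of type c); vertex set restricted separately
H0Adj : (m a b : ℕ) → Vertex m → Vertex m → Set
H0Adj m a b x y = OuterE m a b 0 x y ⊎ InnerE m a b 0 x y ⊎ Spoke0E m a b 0 x y

InΛ : (m a b : ℕ) → ℕ → Set
InΛ m a b x = ∃[ i ] ∃[ j ] (x ≡ i * a + j * b [mod m ])

InH0 : (m a b : ℕ) → Vertex m → Set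
InH0 m a b (s , x) = InΛ m a b (toℕ x)

next : ∀ {n} → Fin n → Fin n
next {suc n} i = fromℕ< (m%n<n (suc (toℕ i)) (suc n))

record IsHamCycle {W : Set} (Adj : W → W → Set) (InV : W → Set)
                  (n : ℕ) (f : Fin n → W) : Set where
  field
    length≥3  : 3 ≤ n
    inV       : ∀ i → InV (f i)
    injective : Injective _≡_ _≡_ f
    covers    : ∀ w → InV w → ∃[ i ] (f i ≡ w)
    adjacent  : ∀ i → Adj (f i) (f (next i))

Connected : {W : Set} → (W → W → Set) → Set
Connected {W} Adj = ∀ (x y : W) → Star Adj x y

Hamiltonian : {W : Set} → (W → W → Set) → Set
Hamiltonian {W} Adj = ∃[ n ] Σ (Fin n → W) (λ f → IsHamCycle Adj (λ _ → ⊤) n f)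

-- alternating: no two consecutive edges of the cycle are both outer or both
-- inner (i.e. every maximal outer/inner subpath has exactly one edge)
IsAlternating : (m a b : ℕ) (n : ℕ) (f : Fin n → Vertex m) → Set
IsAlternating m a b n f = ∀ i →
    ¬ (OuterE m a b 0 (f i) (f (next i)) × OuterE m a b 0 (f (next i)) (f (next (next i))))
  × ¬ (InnerE m a b 0 (f i) (f (next i)) × InnerE m a b 0 (f (next i)) (f (next (next i))))

HasAltHamCycleH0 : (m a b : ℕ) → Set
HasAltHamCycleH0 m a b = ∃[ n ] Σ (Fin n → Vertex m) (λ f →
  IsHamCycle (H0Adj m a b) (InH0 m a b) n f × IsAlternating m a b n f)

module Submission where

-- Write the alternating Hamilton cycle of H₀ as the cyclic sequence of its spokes u_x v_x
-- (x running once through Λ), consecutive spokes being joined by inner and outer edges.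
-- Let d be the order of c modulo Λ. As G is connected, a, b and c generate ℤ_m, so every
-- z ∈ ℤ_m is l + j c with j < d and l ∈ Λ both unique. Replace each spoke u_x v_x of the
-- cycle by the zigzag u_x v_{x+c} u_{x+c} v_{x+2c} … u_{x+(d-1)c} v_{x+dc} of spokes of
-- types c and 0, run backwards when the cycle enters the spoke at v_x. An inner edge
-- v_x v_{x'} of the cycle becomes the inner edge v_{x+dc} v_{x'+dc}, an outer edge stays
-- as it is, and since d c ∈ Λ the zigzags pass through every vertex of G exactly once.
-- The construction uses none of the remaining hypotheses (bounds on a, b, c, the
-- conditions on 2a and 2b, and gcd(m, a, b) > 1).

open import Defs
open import Data.Empty using (⊥; ⊥-elim)
open import Data.Fin as Fin using (Fin; toℕ; fromℕ<)
open import Data.Fin.Properties as Fin using ()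
open import Data.Integer as ℤ using ()
open import Data.Integer.Properties as ℤ using ()
open import Data.Nat using (ℕ; zero; suc; _+_; _*_; _∸_; _≤_; _<_; z≤n; s≤s)
open import Data.Nat.DivMod
open import Data.Nat.Divisibility using (_∣_; divides; n∣m*n)
open import Data.Nat.GCD using (gcd)
open import Data.Nat.Properties as ℕ using ()
open import Algebra.Properties.CommutativeSemigroup ℕ.+-commutativeSemigroup
  using (interchange; x∙yz≈xz∙y; xy∙z≈xz∙y)
open import Data.Product using (_×_; _,_; ∃; ∃-syntax; proj₁; proj₂; map₁)
open import Data.Sum using (_⊎_; inj₁; inj₂; [_,_]′)
open import Data.Unit using (tt)
open import Function using (_∘_)
open import Relation.Binary using (Setoid; IsEquivalence)
open import Relation.Binary.Construct.Closure.ReflexiveTransitive using (fold)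
open import Relation.Binary.Definitions using (tri<; tri≈; tri>)
open import Relation.Binary.PropositionalEquality
import Relation.Binary.Reasoning.Setoid as SetoidReasoning
open import Relation.Nullary using (¬_; ¬?)
import Relation.Nullary.Decidable as Dec
open import Relation.Unary using (Decidable)

-- Arithmetic modulo n on natural-number representatives; n-1 * x stands for -x.

module Residue (n-1 : ℕ) where

  n : ℕ
  n = suc n-1

  -- A record rather than an abbreviation of x % n ≡ y % n, so that x and y can be inferred.
  infix 4 _≋_
  record _≋_ (x y : ℕ) : Set where
    constructor mod-eq
    field %-eq : x % n ≡ y % n
  open _≋_ public

  ≋-isEquivalence : IsEquivalence _≋_
  ≋-isEquivalence = record
    { refl  = mod-eq refl
    ; sym   = λ p → mod-eq (sym (%-eq p))
    ; trans = λ p q → mod-eq (trans (%-eq p) (%-eq q))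
    }

  ≋-setoid : Setoid _ _
  ≋-setoid = record { isEquivalence = ≋-isEquivalence }

  open IsEquivalence ≋-isEquivalence public
    using () renaming (refl to ≋-refl; sym to ≋-sym; trans to ≋-trans; reflexive to ≡⇒≋)

  module ≋-Reasoning = SetoidReasoning ≋-setoid

  ≋-+ : ∀ {x x′ y y′} → x ≋ x′ → y ≋ y′ → x + y ≋ x′ + y′
  ≋-+ {x} {x′} {y} {y′} (mod-eq p) (mod-eq q) = mod-eq (begin
    (x + y) % n            ≡⟨ %-distribˡ-+ x y n ⟩
    (x % n + y % n) % n    ≡⟨ cong₂ (λ s t → (s + t) % n) p q ⟩
    (x′ % n + y′ % n) % n  ≡⟨ %-distribˡ-+ x′ y′ n ⟨
    (x′ + y′) % n          ∎)
    where open ≡-Reasoning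

  ≋-* : ∀ {x x′ y y′} → x ≋ x′ → y ≋ y′ → x * y ≋ x′ * y′
  ≋-* {x} {x′} {y} {y′} (mod-eq p) (mod-eq q) = mod-eq (begin
    (x * y) % n              ≡⟨ %-distribˡ-* x y n ⟩
    (x % n * (y % n)) % n    ≡⟨ cong₂ (λ s t → (s * t) % n) p q ⟩
    (x′ % n * (y′ % n)) % n  ≡⟨ %-distribˡ-* x′ y′ n ⟨
    (x′ * y′) % n            ∎)
    where open ≡-Reasoning

  +-congˡ-≋ : ∀ x {y y′} → y ≋ y′ → x + y ≋ x + y′
  +-congˡ-≋ x = ≋-+ (≋-refl {x})

  +-congʳ-≋ : ∀ {x x′} y → x ≋ x′ → x + y ≋ x′ + y
  +-congʳ-≋ y p = ≋-+ p (≋-refl {y})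

  x%n≋x : ∀ x → x % n ≋ x
  x%n≋x x = mod-eq (m%n%n≡m%n x n)

  n+x≋x : ∀ x → n + x ≋ x
  n+x≋x x = mod-eq (trans (cong (_% n) (ℕ.+-comm n x)) ([m+n]%n≡m%n x n))

  x+kn≋x : ∀ x k → x + k * n ≋ x
  x+kn≋x x k = mod-eq ([m+kn]%n≡m%n x k n)

  x+[n-1]x≋0 : ∀ x → x + n-1 * x ≋ 0
  x+[n-1]x≋0 x = mod-eq (trans (cong (_% n) (ℕ.*-comm n x)) (m*n%n≡0 x n))

  x+z+[n-1]z≋x : ∀ x z → x + z + n-1 * z ≋ x
  x+z+[n-1]z≋x x z = begin
    x + z + n-1 * z      ≡⟨ ℕ.+-assoc x z _ ⟩
    x + (z + n-1 * z)    ≈⟨ +-congˡ-≋ x (x+[n-1]x≋0 z) ⟩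
    x + 0                ≡⟨ ℕ.+-identityʳ x ⟩
    x                    ∎
    where open ≋-Reasoning

  +-cancelʳ-≋ : ∀ {x y} z → x + z ≋ y + z → x ≋ y
  +-cancelʳ-≋ {x} {y} z p = begin
    x                    ≈⟨ x+z+[n-1]z≋x x z ⟨
    x + z + n-1 * z      ≈⟨ +-congʳ-≋ (n-1 * z) p ⟩
    y + z + n-1 * z      ≈⟨ x+z+[n-1]z≋x y z ⟩
    y                    ∎
    where open ≋-Reasoning

  x≋y+z⇒y≋x+[n-1]z : ∀ {x y} z → x ≋ y + z → y ≋ x + n-1 * z
  x≋y+z⇒y≋x+[n-1]z {x} {y} z p = begin
    y                    ≈⟨ x+z+[n-1]z≋x y z ⟨
    y + z + n-1 * z      ≈⟨ +-congʳ-≋ (n-1 * z) p ⟨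
    x + n-1 * z          ∎
    where open ≋-Reasoning

  ≋⇒≡ : ∀ {x y} → x < n → y < n → x ≋ y → x ≡ y
  ≋⇒≡ x<n y<n (mod-eq p) = trans (sym (m<n⇒m%n≡m x<n)) (trans p (m<n⇒m%n≡m y<n))

  ∣∸⇒≋ : ∀ {x y} → y ≤ x → n ∣ x ∸ y → x ≋ y
  ∣∸⇒≋ {x} {y} y≤x (divides k x∸y≡kn) = begin
    x              ≡⟨ ℕ.m+[n∸m]≡n y≤x ⟨
    y + (x ∸ y)    ≡⟨ cong (y +_) x∸y≡kn ⟩
    y + k * n      ≈⟨ x+kn≋x y k ⟩
    y              ∎
    where open ≋-Reasoning

  ≋⇒∣∸ : ∀ {x y} → x ≋ y → n ∣ x ∸ y
  ≋⇒∣∸ {x} {y} (mod-eq p) = divides (x / n ∸ y / n) (begin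
    x ∸ y                                      ≡⟨ cong₂ _∸_ (m≡m%n+[m/n]*n x n) (m≡m%n+[m/n]*n y n) ⟩
    (x % n + x / n * n) ∸ (y % n + y / n * n)  ≡⟨ cong (λ r → (x % n + x / n * n) ∸ (r + y / n * n)) p ⟨
    (x % n + x / n * n) ∸ (x % n + y / n * n)  ≡⟨ ℕ.[m+n]∸[m+o]≡n∸o (x % n) _ _ ⟩
    x / n * n ∸ y / n * n                      ≡⟨ ℕ.*-distribʳ-∸ n (x / n) (y / n) ⟨
    (x / n ∸ y / n) * n                        ∎)
    where open ≡-Reasoning

  ∣[+x]-[+y]∣≡y∸x : ∀ {x y} → x ≤ y → ℤ.∣ ℤ.+ x ℤ.- ℤ.+ y ∣ ≡ y ∸ x
  ∣[+x]-[+y]∣≡y∸x {x} {y} x≤y = trans (cong ℤ.∣_∣ (ℤ.[+m]-[+n]≡m⊖n x y)) (ℤ.∣⊖∣-≤ x≤y)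

  ∣[+x]-[+y]∣≡x∸y : ∀ {x y} → y ≤ x → ℤ.∣ ℤ.+ x ℤ.- ℤ.+ y ∣ ≡ x ∸ y
  ∣[+x]-[+y]∣≡x∸y {x} {y} y≤x = trans (ℤ.∣i-j∣≡∣j-i∣ (ℤ.+ x) (ℤ.+ y)) (∣[+x]-[+y]∣≡y∸x y≤x)

  [mod]⇒≋ : ∀ {x y} → x ≡ y [mod n ] → x ≋ y
  [mod]⇒≋ {x} {y} p with ℕ.≤-total y x
  ... | inj₁ y≤x = ∣∸⇒≋ y≤x (subst (n ∣_) (∣[+x]-[+y]∣≡x∸y y≤x) p)
  ... | inj₂ x≤y = ≋-sym (∣∸⇒≋ x≤y (subst (n ∣_) (∣[+x]-[+y]∣≡y∸x x≤y) p))

  ≋⇒[mod] : ∀ {x y} → x ≋ y → x ≡ y [mod n ]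
  ≋⇒[mod] {x} {y} p with ℕ.≤-total y x
  ... | inj₁ y≤x = subst (n ∣_) (sym (∣[+x]-[+y]∣≡x∸y y≤x)) (≋⇒∣∸ p)
  ... | inj₂ x≤y = subst (n ∣_) (sym (∣[+x]-[+y]∣≡y∸x x≤y)) (≋⇒∣∸ (≋-sym p))

  fin : ℕ → Fin n
  fin x = fromℕ< (m%n<n x n)

  toℕ-fin : ∀ x → toℕ (fin x) ≋ x
  toℕ-fin x = ≋-trans (≡⇒≋ (Fin.toℕ-fromℕ< _)) (x%n≋x x)

  fin-cong : ∀ {x y} → x ≋ y → fin x ≡ fin y
  fin-cong (mod-eq p) = Fin.fromℕ<-cong _ _ p _ _

  fin-injective : ∀ {x y} → fin x ≡ fin y → x ≋ y
  fin-injective {x} {y} e = begin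
    x            ≈⟨ toℕ-fin x ⟨
    toℕ (fin x)  ≡⟨ cong toℕ e ⟩
    toℕ (fin y)  ≈⟨ toℕ-fin y ⟩
    y            ∎
    where open ≋-Reasoning

  fin-toℕ : ∀ i → fin (toℕ i) ≡ i
  fin-toℕ i = Fin.toℕ-injective (≋⇒≡ (Fin.toℕ<n _) (Fin.toℕ<n i) (toℕ-fin (toℕ i)))

  ≋toℕ⇒fin≡ : ∀ {x} {i : Fin n} → x ≋ toℕ i → fin x ≡ i
  ≋toℕ⇒fin≡ {i = i} x≋i = trans (fin-cong x≋i) (fin-toℕ i)

  toℕ-≋-injective : ∀ {i j : Fin n} → toℕ i ≋ toℕ j → i ≡ j
  toℕ-≋-injective {i} i≋j = trans (sym (fin-toℕ i)) (≋toℕ⇒fin≡ i≋j)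

  next-fin : ∀ x → next (fin x) ≡ fin (suc x)
  next-fin x = fin-cong (+-congˡ-≋ 1 (toℕ-fin x))

  Diff⇒≋ : ∀ {d x y} → Diff n d x y → y ≋ x + d ⊎ y ≋ x + n-1 * d
  Diff⇒≋ (inj₁ p) = inj₁ ([mod]⇒≋ p)
  Diff⇒≋ {d} (inj₂ p) = inj₂ (x≋y+z⇒y≋x+[n-1]z d ([mod]⇒≋ p))

  toℕ-fin-+ : ∀ x d → toℕ (fin (x + d)) ≋ toℕ (fin x) + d
  toℕ-fin-+ x d = ≋-trans (toℕ-fin (x + d)) (+-congʳ-≋ d (≋-sym (toℕ-fin x)))

  toℕ-fin-shift : ∀ {d x y} e → y ≋ x + d → toℕ (fin (y + e)) ≋ toℕ (fin (x + e)) + d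
  toℕ-fin-shift {d} {x} {y} e p = begin
    toℕ (fin (y + e))      ≈⟨ toℕ-fin (y + e) ⟩
    y + e                  ≈⟨ +-congʳ-≋ e p ⟩
    x + d + e              ≡⟨ xy∙z≈xz∙y x d e ⟩
    x + e + d              ≈⟨ +-congʳ-≋ d (toℕ-fin (x + e)) ⟨
    toℕ (fin (x + e)) + d  ∎
    where open ≋-Reasoning

  Diff-shift : ∀ {d x y} e → Diff n d x y → Diff n d (toℕ (fin (x + e))) (toℕ (fin (y + e)))
  Diff-shift {d} {x} {y} e (inj₁ p) = inj₁ (≋⇒[mod] (toℕ-fin-shift {d} {x} {y} e ([mod]⇒≋ {y} {x + d} p)))
  Diff-shift {d} {x} {y} e (inj₂ p) = inj₂ (≋⇒[mod] (toℕ-fin-shift {d} {y} {x} e ([mod]⇒≋ {x} {y + d} p)))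

  -- In the finite group ℤ_n closure under + already gives closure under negation, via *-closed n-1.
  record IsSubgroup (P : ℕ → Set) : Set where
    field
      ≋-resp   : ∀ {x y} → x ≋ y → P x → P y
      0∈       : P 0
      +-closed : ∀ {x y} → P x → P y → P (x + y)

    *-closed : ∀ k {x} → P x → P (k * x)
    *-closed zero    _  = 0∈
    *-closed (suc k) px = +-closed px (*-closed k px)

    difference-closed : ∀ {x y z} → P x → P y → x ≋ y + z → P z
    difference-closed {x} {y} {z} px py x≋y+z =
      ≋-resp (≋-sym (x≋y+z⇒y≋x+[n-1]z y (≋-trans x≋y+z (≡⇒≋ (ℕ.+-comm y z))))) (+-closed px (*-closed n-1 py))

    Diff-closed : ∀ {d x y} → P d → Diff n d x y → P x → P y
    Diff-closed pd diff px with Diff⇒≋ diff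
    ... | inj₁ y≋x+d   = ≋-resp (≋-sym y≋x+d) (+-closed px pd)
    ... | inj₂ y≋x-d   = ≋-resp (≋-sym y≋x-d) (+-closed px (*-closed n-1 pd))

  infixl 6 _+⟨_⟩
  _+⟨_⟩ : (ℕ → Set) → ℕ → ℕ → Set
  (P +⟨ c ⟩) z = ∃[ l ] ∃[ k ] (P l × z ≋ l + k * c)

  module _ {P : ℕ → Set} (P-sub : IsSubgroup P) (c : ℕ) where
    open IsSubgroup P-sub

    +⟨⟩-isSubgroup : IsSubgroup (P +⟨ c ⟩)
    +⟨⟩-isSubgroup = record
      { ≋-resp   = λ { x≋y (l , k , pl , x≋) → l , k , pl , ≋-trans (≋-sym x≋y) x≋ }
      ; 0∈       = 0 , 0 , 0∈ , ≋-refl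
      ; +-closed = λ { (l , k , pl , x≋) (l′ , k′ , pl′ , y≋) →
                       l + l′ , k + k′ , +-closed pl pl′ , ≋-trans (≋-+ x≋ y≋) (≡⇒≋ (regroup l k l′ k′)) }
      }
      where
        regroup : ∀ l k l′ k′ → l + k * c + (l′ + k′ * c) ≡ l + l′ + (k + k′) * c
        regroup l k l′ k′ = trans (interchange l (k * c) l′ (k′ * c)) (cong (l + l′ +_) (sym (ℕ.*-distribʳ-+ c k k′)))

    ∈+⟨⟩ : ∀ {l} → P l → (P +⟨ c ⟩) l
    ∈+⟨⟩ {l} pl = l , 0 , pl , ≡⇒≋ (sym (ℕ.+-identityʳ l))

    generator∈+⟨⟩ : (P +⟨ c ⟩) c
    generator∈+⟨⟩ = 0 , 1 , 0∈ , ≡⇒≋ (sym (ℕ.+-identityʳ c))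

    module Cosets (P? : Decidable P) where
      private
        P[n*c] : P (suc (toℕ (Fin.fromℕ n-1)) * c)
        P[n*c] = subst (λ k → P (suc k * c)) (sym (Fin.toℕ-fromℕ n-1)) (≋-resp (≋-sym (x+[n-1]x≋0 c)) 0∈)

        smallest : ∃ λ i → ¬ ¬ P (suc (toℕ i) * c) × ((j : Fin.Fin′ i) → ¬ P (suc (toℕ (Fin.inject j)) * c))
        smallest = Fin.¬∀⟶∃¬-smallest n (λ i → ¬ P (suc (toℕ i) * c)) (λ i → ¬? (P? _))
                     (λ none → none (Fin.fromℕ n-1) P[n*c])

      -- abstract, so that typechecking never evaluates the search for the order.
      abstract
        order-1 : ℕ
        order-1 = toℕ (proj₁ smallest)

      order : ℕ
      order = suc order-1

      abstract
        P[order*c] : P (order * c)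
        P[order*c] = Dec.decidable-stable (P? _) (proj₁ (proj₂ smallest))

        order-minimal : ∀ {e} → 0 < e → e < order → ¬ P (e * c)
        order-minimal {suc e} _ (s≤s e<order-1) =
          subst (λ k → ¬ P (suc k * c)) (trans (Fin.toℕ-inject j) (Fin.toℕ-fromℕ< e<order-1)) (proj₂ (proj₂ smallest) j)
          where
            j : Fin.Fin′ (proj₁ smallest)
            j = fromℕ< e<order-1

      private
        gap∈P : ∀ {l l′ j j′} → P l → P l′ → j < j′ → l + j * c ≋ l′ + j′ * c → P ((j′ ∸ j) * c)
        gap∈P {l} {l′} {j} {j′} pl pl′ j<j′ eq =
          difference-closed pl pl′ (+-cancelʳ-≋ (j * c) (≋-trans eq (≡⇒≋ split)))
          where
            split : l′ + j′ * c ≡ l′ + (j′ ∸ j) * c + j * c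
            split = begin
              l′ + j′ * c                        ≡⟨ cong (λ k → l′ + k * c) (ℕ.m+[n∸m]≡n (ℕ.<⇒≤ j<j′)) ⟨
              l′ + (j + (j′ ∸ j)) * c            ≡⟨ cong (l′ +_) (ℕ.*-distribʳ-+ c j (j′ ∸ j)) ⟩
              l′ + (j * c + (j′ ∸ j) * c)        ≡⟨ x∙yz≈xz∙y l′ (j * c) ((j′ ∸ j) * c) ⟩
              l′ + (j′ ∸ j) * c + j * c          ∎
              where open ≡-Reasoning

        gap∉P : ∀ {j j′} → j < j′ → j′ < order → ¬ P ((j′ ∸ j) * c)
        gap∉P {j} {j′} j<j′ j′<order = order-minimal (ℕ.m<n⇒0<n∸m j<j′) (ℕ.≤-<-trans (ℕ.m∸n≤m j′ j) j′<order)

      coset-unique : ∀ {l l′ j j′} → P l → P l′ → j < order → j′ < order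
        → l + j * c ≋ l′ + j′ * c → j ≡ j′ × l ≋ l′
      coset-unique {j = j} {j′} pl pl′ j<order j′<order eq with ℕ.<-cmp j j′
      ... | tri< j<j′ _ _ = ⊥-elim (gap∉P j<j′ j′<order (gap∈P pl pl′ j<j′ eq))
      ... | tri≈ _ refl _ = refl , +-cancelʳ-≋ (j * c) eq
      ... | tri> _ _ j′<j = ⊥-elim (gap∉P j′<j j<order (gap∈P pl′ pl j′<j (≋-sym eq)))

      coset-decompose : ∀ {z} → (P +⟨ c ⟩) z → ∃[ l ] ∃[ j ] (P l × j < order × z ≋ l + j * c)
      coset-decompose {z} (l , k , pl , z≋l+kc) =
        l + k / order * (order * c) , k % order ,
        +-closed pl (*-closed (k / order) P[order*c]) , m%n<n k order ,
        ≋-trans z≋l+kc (≡⇒≋ regroup)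
        where
          regroup : l + k * c ≡ l + k / order * (order * c) + k % order * c
          regroup = begin
            l + k * c                                              ≡⟨ cong (λ t → l + t * c) (m≡m%n+[m/n]*n k order) ⟩
            l + (k % order + k / order * order) * c                ≡⟨ cong (l +_) (ℕ.*-distribʳ-+ c (k % order) _) ⟩
            l + (k % order * c + k / order * order * c)            ≡⟨ x∙yz≈xz∙y l (k % order * c) _ ⟩
            l + k / order * order * c + k % order * c              ≡⟨ cong (λ t → l + t + k % order * c) (ℕ.*-assoc (k / order) order c) ⟩
            l + k / order * (order * c) + k % order * c            ∎
            where open ≡-Reasoning

-- Hamilton cycles from periodic sequences

module _ {W : Set} {Adj : W → W → Set} where

  hamiltonian-from-sequence : (n : ℕ) → 3 ≤ n → (G : ℕ → W)
    → (∀ q → Adj (G q) (G (suc q))) → G n ≡ G 0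
    → (∀ {q q′} → q < n → q′ < n → G q ≡ G q′ → q ≡ q′)
    → (∀ w → ∃[ q ] (q < n × G q ≡ w))
    → Hamiltonian Adj
  hamiltonian-from-sequence n@(suc _) 3≤n G adj closed inj cov = n , G ∘ toℕ , record
    { length≥3  = 3≤n
    ; inV       = λ _ → tt
    ; injective = Fin.toℕ-injective ∘ inj (Fin.toℕ<n _) (Fin.toℕ<n _)
    ; covers    = λ w _ → let q , q<n , Gq≡w = cov w in
                  fromℕ< q<n , trans (cong G (Fin.toℕ-fromℕ< q<n)) Gq≡w
    ; adjacent  = λ i → subst (Adj (G (toℕ i)) ∘ G) (sym (Fin.toℕ-fromℕ< _))
                               (adj-mod (toℕ i) (ℕ.m≤n⇒m<n∨m≡n (Fin.toℕ<n i)))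
    }
    where
      adj-mod : ∀ q → suc q < n ⊎ suc q ≡ n → Adj (G q) (G (suc q % n))
      adj-mod q (inj₁ 1+q<n) = subst (Adj (G q) ∘ G) (sym (m<n⇒m%n≡m 1+q<n)) (adj q)
      adj-mod q (inj₂ refl)  = subst (Adj (G q)) (trans closed (cong G (sym (n%n≡0 n)))) (adj q)

  module _ (R L-1 : ℕ) (B : ℕ → ℕ → W) where
    private
      L : ℕ
      L = suc L-1

      G : ℕ → W
      G q = B (q / L) (q % L)

      G-block : ∀ {t} r → t < L → G (t + r * L) ≡ B r t
      G-block {t} r t<L = cong₂ B quotient remainder
        where
          remainder : (t + r * L) % L ≡ t
          remainder = trans ([m+kn]%n≡m%n t r L) (m<n⇒m%n≡m t<L)
          quotient : (t + r * L) / L ≡ r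
          quotient = begin
            (t + r * L) / L      ≡⟨ +-distrib-/-∣ʳ t (n∣m*n r) ⟩
            t / L + r * L / L    ≡⟨ cong₂ _+_ (m<n⇒m/n≡0 t<L) (m*n/n≡m r L) ⟩
            r                    ∎
            where open ≡-Reasoning

    hamiltonian-from-blocks : 3 ≤ R * L
      → (∀ r t → t < L-1 → Adj (B r t) (B r (suc t)))
      → (∀ r → Adj (B r L-1) (B (suc r) 0))
      → B R 0 ≡ B 0 0
      → (∀ {r r′ t t′} → r < R → r′ < R → t < L → t′ < L → B r t ≡ B r′ t′ → r ≡ r′ × t ≡ t′)
      → (∀ w → ∃[ r ] ∃[ t ] (r < R × t < L × B r t ≡ w))
      → Hamiltonian Adj
    hamiltonian-from-blocks 3≤RL adj-in adj-out closed inj cov =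
      hamiltonian-from-sequence (R * L) 3≤RL G adj closed′ inj′ cov′
      where
        adj : ∀ q → Adj (G q) (G (suc q))
        adj q = subst (Adj (G q) ∘ G) (cong suc (sym (m≡m%n+[m/n]*n q L)))
                  (step (q % L) (q / L) (ℕ.m≤n⇒m<n∨m≡n (m%n<n q L)))
          where
            step : ∀ t r → suc t < L ⊎ suc t ≡ L → Adj (B r t) (G (suc t + r * L))
            step t r (inj₁ 1+t<L) = subst (Adj (B r t)) (sym (G-block r 1+t<L)) (adj-in r t (ℕ.≤-pred 1+t<L))
            step t r (inj₂ refl)  = subst (Adj (B r t)) (sym (G-block (suc r) (s≤s z≤n))) (adj-out r)
        closed′ : G (R * L) ≡ G 0
        closed′ = trans (G-block R (s≤s z≤n)) closed
        inj′ : ∀ {q q′} → q < R * L → q′ < R * L → G q ≡ G q′ → q ≡ q′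
        inj′ {q} {q′} q<RL q′<RL e
          with r≡r′ , t≡t′ ← inj (m<n*o⇒m/o<n q<RL) (m<n*o⇒m/o<n q′<RL) (m%n<n q L) (m%n<n q′ L) e = begin
            q                    ≡⟨ m≡m%n+[m/n]*n q L ⟩
            q % L + q / L * L    ≡⟨ cong₂ (λ t r → t + r * L) t≡t′ r≡r′ ⟩
            q′ % L + q′ / L * L  ≡⟨ m≡m%n+[m/n]*n q′ L ⟨
            q′                   ∎
          where open ≡-Reasoning
        cov′ : ∀ w → ∃[ q ] (q < R * L × G q ≡ w)
        cov′ w with r , t , r<R , t<L , Brt≡w ← cov w =
          t + r * L , ℕ.<-≤-trans (ℕ.+-monoˡ-< (r * L) t<L) (ℕ.*-monoˡ-≤ L r<R) , trans (G-block r t<L) Brt≡w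

-- Generalized rose window graphs

opposite : Side → Side
opposite U = V
opposite V = U

U≢V : U ≢ V
U≢V ()

same-or-opposite : ∀ s s′ → s ≡ s′ ⊎ s ≡ opposite s′
same-or-opposite U U = inj₁ refl
same-or-opposite U V = inj₂ refl
same-or-opposite V U = inj₂ refl
same-or-opposite V V = inj₁ refl

parity : ∀ q → ∃[ k ] (q ≡ k * 2 ⊎ q ≡ suc (k * 2))
parity zero = 0 , inj₁ refl
parity (suc q) with parity q
... | k , inj₁ refl = k , inj₂ refl
... | k , inj₂ refl = suc k , inj₁ refl

module RoseWindow (m-1 a b : ℕ) where
  open Residue m-1 public renaming (n to m)

  Outer Inner Spoke : Vertex m → Vertex m → Set
  Outer = OuterE m a b 0
  Inner = InnerE m a b 0
  Spoke = Spoke0E m a b 0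

  spoke-target : ∀ {s i y} → Spoke (s , i) y → y ≡ (opposite s , i)
  spoke-target spoke0  = refl
  spoke-target spoke0' = refl

  spokes-return : ∀ {x y z} → Spoke x y → Spoke y z → x ≡ z
  spokes-return spoke0  spoke0' = refl
  spokes-return spoke0' spoke0  = refl

  spoke-or-next-spoke : ∀ {x y z} → H0Adj m a b x y → H0Adj m a b y z
    → ¬ (Outer x y × Outer y z) → ¬ (Inner x y × Inner y z)
    → Spoke x y ⊎ Spoke y z
  spoke-or-next-spoke (inj₂ (inj₂ s))          _                        _      _      = inj₁ s
  spoke-or-next-spoke _                        (inj₂ (inj₂ s))          _      _      = inj₂ s
  spoke-or-next-spoke (inj₁ o)                 (inj₁ o′)                no-oo  _      = ⊥-elim (no-oo (o , o′))
  spoke-or-next-spoke (inj₂ (inj₁ i))          (inj₂ (inj₁ i′))         _      no-ii  = ⊥-elim (no-ii (i , i′))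
  spoke-or-next-spoke (inj₁ (outerE _))        (inj₂ (inj₁ ()))         _      _
  spoke-or-next-spoke (inj₂ (inj₁ (innerE _))) (inj₁ ())                _      _

  outer-or-inner : ∀ {x y} → H0Adj m a b x y → ¬ Spoke x y → Outer x y ⊎ Inner x y
  outer-or-inner (inj₁ o)         _        = inj₁ o
  outer-or-inner (inj₂ (inj₁ i))  _        = inj₂ i
  outer-or-inner (inj₂ (inj₂ s))  no-spoke = ⊥-elim (no-spoke s)

  Λ : ℕ → Set
  Λ = InΛ m a b

  Λ-intro : ∀ {x} i j → x ≋ i * a + j * b → Λ x
  Λ-intro i j x≋ = i , j , ≋⇒[mod] x≋

  Λ-elim : ∀ {x} → Λ x → ∃[ i ] ∃[ j ] (x ≋ i * a + j * b)
  Λ-elim {x} (i , j , x≡) = i , j , [mod]⇒≋ {x} {i * a + j * b} x≡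

  Λ-isSubgroup : IsSubgroup Λ
  Λ-isSubgroup = record
    { ≋-resp   = λ x≋y x∈Λ → let i , j , x≋ = Λ-elim x∈Λ in Λ-intro i j (≋-trans (≋-sym x≋y) x≋)
    ; 0∈       = Λ-intro 0 0 ≋-refl
    ; +-closed = λ x∈Λ y∈Λ → let i , j , x≋ = Λ-elim x∈Λ ; i′ , j′ , y≋ = Λ-elim y∈Λ in
                 Λ-intro (i + i′) (j + j′) (≋-trans (≋-+ x≋ y≋) (≡⇒≋ (regroup i j i′ j′)))
    }
    where
      regroup : ∀ i j i′ j′ → i * a + j * b + (i′ * a + j′ * b) ≡ (i + i′) * a + (j + j′) * b
      regroup i j i′ j′ = begin
        i * a + j * b + (i′ * a + j′ * b)    ≡⟨ interchange (i * a) (j * b) (i′ * a) (j′ * b) ⟩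
        i * a + i′ * a + (j * b + j′ * b)    ≡⟨ cong₂ _+_ (ℕ.*-distribʳ-+ a i i′) (ℕ.*-distribʳ-+ b j j′) ⟨
        (i + i′) * a + (j + j′) * b          ∎
        where open ≡-Reasoning

  a∈Λ : Λ a
  a∈Λ = Λ-intro 1 0 (≡⇒≋ (sym (trans (ℕ.+-identityʳ _) (ℕ.+-identityʳ a))))

  b∈Λ : Λ b
  b∈Λ = Λ-intro 0 1 (≡⇒≋ (sym (ℕ.+-identityʳ b)))

  Λ? : Decidable Λ
  Λ? x = Dec.map′ from to (Fin.any? λ i → Fin.any? λ j → x % m ℕ.≟ (toℕ i * a + toℕ j * b) % m)
    where
      from : (∃ λ i → ∃ λ j → x % m ≡ (toℕ i * a + toℕ j * b) % m) → Λ x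
      from (i , j , x≡) = Λ-intro (toℕ i) (toℕ j) (mod-eq x≡)
      to : Λ x → ∃ λ i → ∃ λ j → x % m ≡ (toℕ i * a + toℕ j * b) % m
      to x∈Λ = let i , j , x≋ = Λ-elim x∈Λ in fin i , fin j , %-eq (≋-trans x≋
                          (≋-+ (≋-* (≋-sym (toℕ-fin i)) ≋-refl) (≋-* (≋-sym (toℕ-fin j)) ≋-refl)))

  -- An alternating Hamilton cycle of H₀ as its cyclic sequence of spokes: the r-th spoke runs
  -- from (side r , rung r) to (opposite (side r) , rung r), and link r is the edge leaving it.
  record Ladder : Set where
    field
      R              : ℕ
      2≤R            : 2 ≤ R
      side           : ℕ → Side
      rung           : ℕ → Fin m
      closed         : (side R , rung R) ≡ (side 0 , rung 0)
      link           : ∀ r → Outer (opposite (side r) , rung r) (side (suc r) , rung (suc r))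
                           ⊎ Inner (opposite (side r) , rung r) (side (suc r) , rung (suc r))
      rung-injective : ∀ {r r′} → r < R → r′ < R → rung r ≡ rung r′ → r ≡ r′
      rung-onto      : ∀ {x} → Λ x → ∃[ r ] (r < R × rung r ≡ fin x)
      rung∈Λ         : ∀ r → Λ (toℕ (rung r))

  module _ (N-1 : ℕ) (f : Fin (suc N-1) → Vertex m)
           (ham : IsHamCycle (H0Adj m a b) (InH0 m a b) (suc N-1) f)
           (alt : IsAlternating m a b (suc N-1) f) where
    private
      module ℤN = Residue N-1
      open IsHamCycle ham
      open IsSubgroup Λ-isSubgroup using (≋-resp)

      N : ℕ
      N = suc N-1

      position : ℕ → Fin N
      position zero    = Fin.zero
      position (suc q) = next (position q)

      position≡fin : ∀ q → position q ≡ ℤN.fin q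
      position≡fin zero    = refl
      position≡fin (suc q) = trans (cong next (position≡fin q)) (ℤN.next-fin q)

      F : ℕ → Vertex m
      F q = f (position q)

      F-≡⇒≋ : ∀ {q q′} → F q ≡ F q′ → q ℤN.≋ q′
      F-≡⇒≋ {q} {q′} e = ℤN.fin-injective (trans (sym (position≡fin q)) (trans (injective e) (position≡fin q′)))

      F-≋⇒≡ : ∀ {q q′} → q ℤN.≋ q′ → F q ≡ F q′
      F-≋⇒≡ {q} {q′} q≋q′ = cong f (trans (position≡fin q) (trans (ℤN.fin-cong q≋q′) (sym (position≡fin q′))))

      Spoke-at : ℕ → Set
      Spoke-at q = Spoke (F q) (F (suc q))

      spoke-periodic : ∀ q → Spoke-at q → Spoke-at (N + q)
      spoke-periodic q = subst₂ Spoke (F-≋⇒≡ (ℤN.≋-sym (ℤN.n+x≋x q)))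
                                      (F-≋⇒≡ (ℤN.≋-sym (ℤN.≋-trans (ℤN.≡⇒≋ (sym (ℕ.+-suc N q))) (ℤN.n+x≋x (suc q)))))

      spoke-alternates : ∀ q → Spoke-at q ⊎ Spoke-at (suc q)
      spoke-alternates q = spoke-or-next-spoke (adjacent (position q)) (adjacent (position (suc q)))
                             (proj₁ (alt (position q))) (proj₂ (alt (position q)))

      no-consecutive-spokes : ∀ q → Spoke-at q → ¬ Spoke-at (suc q)
      no-consecutive-spokes q s s′ with () ← ℤN.≋⇒≡ {0} {2} (s≤s z≤n) length≥3
                                               (ℤN.+-cancelʳ-≋ q (F-≡⇒≋ (spokes-return s s′)))

      first-spoke : ∃[ p ] Spoke-at p
      first-spoke = [ (0 ,_) , (1 ,_) ]′ (spoke-alternates 0)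

      p : ℕ
      p = proj₁ first-spoke

      -- The cycle rotated so that its spokes are exactly the edges at even positions.
      G : ℕ → Vertex m
      G q = F (q + p)

      spoke-even : ∀ k → Spoke-at (k * 2 + p)
      spoke-even zero    = proj₂ first-spoke
      spoke-even (suc k) = [ ⊥-elim ∘ no-consecutive-spokes (k * 2 + p) (spoke-even k) , (λ s → s) ]′
                             (spoke-alternates (suc (k * 2 + p)))

      G-odd : ∀ k → G (suc (k * 2)) ≡ (opposite (proj₁ (G (k * 2))) , proj₂ (G (k * 2)))
      G-odd k = spoke-target (spoke-even k)

      half-length : ∃[ R ] (N ≡ R * 2)
      half-length with parity N
      ... | R , inj₁ N≡R*2      = R , N≡R*2
      ... | k , inj₂ N≡1+k*2    = ⊥-elim (no-consecutive-spokes (k * 2 + p) (spoke-even k)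
                                      (subst (λ t → Spoke-at (t + p)) N≡1+k*2 (spoke-periodic p (proj₂ first-spoke))))

      R : ℕ
      R = proj₁ half-length

      N≡R*2 : N ≡ R * 2
      N≡R*2 = proj₂ half-length

      odd<N : ∀ {r} → r < R → suc (r * 2) < N
      odd<N {r} r<R = subst (suc (r * 2) <_) (sym N≡R*2) (ℕ.*-monoˡ-≤ 2 r<R)

      even<N : ∀ {r} → r < R → r * 2 < N
      even<N r<R = ℕ.<-trans (ℕ.n<1+n _) (odd<N r<R)

      half<R : ∀ {k} → k * 2 < N → k < R
      half<R {k} k*2<N = ℕ.*-cancelʳ-< 2 k R (subst (k * 2 <_) N≡R*2 k*2<N)

      G-injective : ∀ {q q′} → q < N → q′ < N → G q ≡ G q′ → q ≡ q′
      G-injective q<N q′<N e = ℤN.≋⇒≡ q<N q′<N (ℤN.+-cancelʳ-≋ p (F-≡⇒≋ e))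

      G-onto : ∀ {w} → InH0 m a b w → ∃[ q ] (q < N × G q ≡ w)
      G-onto w∈H0 with i , fi≡w ← covers _ w∈H0 =
        q , m%n<n (toℕ i + N-1 * p) N , trans (F-≋⇒≡ q+p≋i) (trans (cong f (trans (position≡fin (toℕ i)) (ℤN.fin-toℕ i))) fi≡w)
        where
          q : ℕ
          q = (toℕ i + N-1 * p) % N
          q+p≋i : q + p ℤN.≋ toℕ i
          q+p≋i = begin
            q + p                   ≈⟨ ℤN.+-congʳ-≋ p (ℤN.x%n≋x (toℕ i + N-1 * p)) ⟩
            toℕ i + N-1 * p + p     ≡⟨ xy∙z≈xz∙y (toℕ i) _ p ⟩
            toℕ i + p + N-1 * p     ≈⟨ ℤN.x+z+[n-1]z≋x (toℕ i) p ⟩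
            toℕ i                   ∎
            where open ℤN.≋-Reasoning

      side : ℕ → Side
      side r = proj₁ (G (r * 2))

      rung : ℕ → Fin m
      rung r = proj₂ (G (r * 2))

      rung-injective : ∀ {r r′} → r < R → r′ < R → rung r ≡ rung r′ → r ≡ r′
      rung-injective {r} {r′} r<R r′<R e with same-or-opposite (side r) (side r′)
      ... | inj₁ same     = ℕ.*-cancelʳ-≡ r r′ 2 (G-injective (even<N r<R) (even<N r′<R) (cong₂ _,_ same e))
      ... | inj₂ opposed  = ⊥-elim (ℕ.even≢odd r r′ (trans (ℕ.*-comm 2 r) (trans
                              (G-injective (even<N r<R) (odd<N r′<R) (trans (cong₂ _,_ opposed e) (sym (G-odd r′))))
                              (cong suc (ℕ.*-comm r′ 2)))))

      rung-onto : ∀ {x} → Λ x → ∃[ r ] (r < R × rung r ≡ fin x)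
      rung-onto {x} x∈Λ = rung-at (G-onto {U , fin x} (≋-resp (≋-sym (toℕ-fin x)) x∈Λ))
        where
          rung-at : ∃[ q ] (q < N × G q ≡ (U , fin x)) → ∃[ r ] (r < R × rung r ≡ fin x)
          rung-at (q , q<N , Gq≡u) with parity q
          ... | k , inj₁ refl = k , half<R q<N , cong proj₂ Gq≡u
          ... | k , inj₂ refl = k , half<R (ℕ.<-trans (ℕ.n<1+n _) q<N) , cong proj₂ (trans (sym (G-odd k)) Gq≡u)

      link : ∀ r → Outer (opposite (side r) , rung r) (side (suc r) , rung (suc r))
                 ⊎ Inner (opposite (side r) , rung r) (side (suc r) , rung (suc r))
      link r = subst (λ x → Outer x (G (suc r * 2)) ⊎ Inner x (G (suc r * 2))) (G-odd r)
                 (outer-or-inner (adjacent (position (suc (r * 2) + p)))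
                                 (no-consecutive-spokes (r * 2 + p) (spoke-even r)))

    alternating⇒ladder : Ladder
    alternating⇒ladder = record
      { R              = R
      ; 2≤R            = ℕ.*-cancelʳ-< 2 1 R (subst (2 <_) N≡R*2 length≥3)
      ; side           = side
      ; rung           = rung
      ; closed         = trans (cong (λ t → F (t + p)) (sym N≡R*2)) (F-≋⇒≡ (ℤN.n+x≋x p))
      ; link           = link
      ; rung-injective = rung-injective
      ; rung-onto      = rung-onto
      ; rung∈Λ         = λ r → inV (position (r * 2 + p))
      }

  module _ (c : ℕ) where

    RAdj-closed : ∀ {S} → IsSubgroup S → S a → S b → S c
      → ∀ {x y} → RAdj m a b c x y → S (toℕ (proj₂ x)) → S (toℕ (proj₂ y))
    RAdj-closed S-sub a∈S b∈S c∈S = λ where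
        (inj₁ (outerE d))                → Diff-closed a∈S d
        (inj₂ (inj₁ (innerE d)))         → Diff-closed b∈S d
        (inj₂ (inj₂ (inj₁ spoke0)))      → λ x∈S → x∈S
        (inj₂ (inj₂ (inj₁ spoke0')))     → λ x∈S → x∈S
        (inj₂ (inj₂ (inj₂ (spokeC d))))  → Diff-closed c∈S (inj₁ d)
        (inj₂ (inj₂ (inj₂ (spokeC' d)))) → Diff-closed c∈S (inj₂ d)
      where open IsSubgroup S-sub

    connected⇒generated : Connected (RAdj m a b c) → ∀ {S} → IsSubgroup S → S a → S b → S c → ∀ x → S x
    connected⇒generated conn {S} S-sub a∈S b∈S c∈S x =
      ≋-resp (toℕ-fin x) (fold (λ v w → S (toℕ (proj₂ v)) → S (toℕ (proj₂ w)))
                               (λ e k → k ∘ RAdj-closed S-sub a∈S b∈S c∈S e) (λ x∈S → x∈S)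
                               (conn (U , fin 0) (U , fin x)) (≋-resp (≋-sym (toℕ-fin 0)) 0∈))
      where open IsSubgroup S-sub

    zigzag : ℕ → ℕ → Vertex m
    zigzag x zero                = (U , fin x)
    zigzag x (suc zero)          = (V , fin (x + c))
    zigzag x (suc (suc τ))       = zigzag (x + c) τ

    zigzag-step : ∀ x τ → RAdj m a b c (zigzag x τ) (zigzag x (suc τ))
    zigzag-step x zero          = inj₂ (inj₂ (inj₂ (spokeC (≋⇒[mod] (toℕ-fin-+ x c)))))
    zigzag-step x (suc zero)    = inj₂ (inj₂ (inj₁ spoke0'))
    zigzag-step x (suc (suc τ)) = zigzag-step (x + c) τ

    zigzag-step⁻ : ∀ x τ → RAdj m a b c (zigzag x (suc τ)) (zigzag x τ)
    zigzag-step⁻ x zero          = inj₂ (inj₂ (inj₂ (spokeC' (≋⇒[mod] (toℕ-fin-+ x c)))))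
    zigzag-step⁻ x (suc zero)    = inj₂ (inj₂ (inj₁ spoke0))
    zigzag-step⁻ x (suc (suc τ)) = zigzag-step⁻ (x + c) τ

    zigzag-even : ∀ x k → zigzag x (k * 2) ≡ (U , fin (x + k * c))
    zigzag-even x zero    = cong (λ y → U , fin y) (sym (ℕ.+-identityʳ x))
    zigzag-even x (suc k) = trans (zigzag-even (x + c) k) (cong (λ y → U , fin y) (ℕ.+-assoc x c (k * c)))

    zigzag-odd : ∀ x k → zigzag x (suc (k * 2)) ≡ (V , fin (x + suc k * c))
    zigzag-odd x zero    = cong (λ y → V , fin (x + y)) (sym (ℕ.+-identityʳ c))
    zigzag-odd x (suc k) = trans (zigzag-odd (x + c) k) (cong (λ y → V , fin y) (ℕ.+-assoc x c (suc k * c)))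

    zigzag-cong : ∀ {x x′} τ → x ≋ x′ → zigzag x τ ≡ zigzag x′ τ
    zigzag-cong zero          x≋x′ = cong (U ,_) (fin-cong x≋x′)
    zigzag-cong (suc zero)    x≋x′ = cong (V ,_) (fin-cong (+-congʳ-≋ c x≋x′))
    zigzag-cong (suc (suc τ)) x≋x′ = zigzag-cong τ (+-congʳ-≋ c x≋x′)

    module _ (conn : Connected (RAdj m a b c)) (ladder : Ladder) where
      open Ladder ladder
      open IsSubgroup Λ-isSubgroup
      open Cosets Λ-isSubgroup c Λ?

      private
        decompose : ∀ z → ∃[ l ] ∃[ j ] (Λ l × j < order × z ≋ l + j * c)
        decompose z = coset-decompose (connected⇒generated conn (+⟨⟩-isSubgroup Λ-isSubgroup c)
                        (∈+⟨⟩ Λ-isSubgroup c a∈Λ) (∈+⟨⟩ Λ-isSubgroup c b∈Λ) (generator∈+⟨⟩ Λ-isSubgroup c) z)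

        last : ℕ
        last = suc (order-1 * 2)

        orient : Side → ℕ → ℕ
        orient U t = t
        orient V t = last ∸ t

        orient-< : ∀ s {t} → t < order * 2 → orient s t < order * 2
        orient-< U t<2d = t<2d
        orient-< V {t} _ = s≤s (ℕ.m∸n≤m last t)

        orient-involutive : ∀ s {t} → t < order * 2 → orient s (orient s t) ≡ t
        orient-involutive U _    = refl
        orient-involutive V t<2d = ℕ.m∸[m∸n]≡n (ℕ.≤-pred t<2d)

        orient-injective : ∀ s {t t′} → t < order * 2 → t′ < order * 2 → orient s t ≡ orient s t′ → t ≡ t′
        orient-injective U _    _     e = e
        orient-injective V t<2d t′<2d e = ℕ.∸-cancelˡ-≡ (ℕ.≤-pred t<2d) (ℕ.≤-pred t′<2d) e

        orient-step : ∀ s x {t} → t < last → RAdj m a b c (zigzag x (orient s t)) (zigzag x (orient s (suc t)))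
        orient-step U x {t} _      = zigzag-step x t
        orient-step V x {t} t<last = subst (λ τ → RAdj m a b c (zigzag x τ) (zigzag x (order-1 * 2 ∸ t)))
                                           (sym (ℕ.+-∸-assoc 1 (ℕ.≤-pred t<last))) (zigzag-step⁻ x (order-1 * 2 ∸ t))

        zigzag-link : ∀ s s′ (i i′ : Fin m) → Outer (opposite s , i) (s′ , i′) ⊎ Inner (opposite s , i) (s′ , i′)
          → RAdj m a b c (zigzag (toℕ i) (orient s last)) (zigzag (toℕ i′) (orient s′ 0))
        zigzag-link U _ _ _ (inj₁ ())
        zigzag-link V V _ _ (inj₁ ())
        zigzag-link V U i i′ (inj₁ (outerE d)) =
          subst₂ (RAdj m a b c) (sym (trans (cong (zigzag (toℕ i)) (ℕ.n∸n≡0 last)) (zigzag-start i)))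
                                (sym (zigzag-start i′)) (inj₁ (outerE d))
          where
            zigzag-start : ∀ i → zigzag (toℕ i) 0 ≡ (U , i)
            zigzag-start i = cong (U ,_) (fin-toℕ i)
        zigzag-link V _ _ _ (inj₂ ())
        zigzag-link U U _ _ (inj₂ ())
        zigzag-link U V i i′ (inj₂ (innerE d)) =
          subst₂ (RAdj m a b c) (sym (zigzag-odd (toℕ i) order-1)) (sym (zigzag-odd (toℕ i′) order-1))
                 (inj₂ (inj₁ (innerE (Diff-shift {b} {toℕ i} {toℕ i′} (order * c) d))))

        zigzag-injective : ∀ {x x′ τ τ′} → Λ x → Λ x′ → τ < order * 2 → τ′ < order * 2
          → zigzag x τ ≡ zigzag x′ τ′ → τ ≡ τ′ × x ≋ x′
        zigzag-injective {x} {x′} {τ} {τ′} x∈Λ x′∈Λ = by-parity (parity τ) (parity τ′)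
          where
            by-parity : ∀ {τ τ′} → ∃[ k ] (τ ≡ k * 2 ⊎ τ ≡ suc (k * 2)) → ∃[ k ] (τ′ ≡ k * 2 ⊎ τ′ ≡ suc (k * 2))
              → τ < order * 2 → τ′ < order * 2 → zigzag x τ ≡ zigzag x′ τ′ → τ ≡ τ′ × x ≋ x′
            by-parity (k , inj₁ refl) (k′ , inj₁ refl) τ<2d τ′<2d e =
              map₁ (cong (_* 2)) (coset-unique x∈Λ x′∈Λ (ℕ.*-cancelʳ-< 2 k order τ<2d) (ℕ.*-cancelʳ-< 2 k′ order τ′<2d)
                (fin-injective (cong proj₂ (trans (sym (zigzag-even x k)) (trans e (zigzag-even x′ k′))))))
            by-parity (k , inj₂ refl) (k′ , inj₂ refl) τ<2d τ′<2d e =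
              map₁ (cong (λ j → suc (j * 2))) (coset-unique x∈Λ x′∈Λ
                (ℕ.*-cancelʳ-< 2 k order (ℕ.<-trans (ℕ.n<1+n (k * 2)) τ<2d))
                (ℕ.*-cancelʳ-< 2 k′ order (ℕ.<-trans (ℕ.n<1+n (k′ * 2)) τ′<2d))
                (+-cancelʳ-≋ c (begin
                  x + k * c + c         ≡⟨ x∙yz≈xz∙y x c (k * c) ⟨
                  x + suc k * c         ≈⟨ fin-injective (cong proj₂ (trans (sym (zigzag-odd x k)) (trans e (zigzag-odd x′ k′)))) ⟩
                  x′ + suc k′ * c       ≡⟨ x∙yz≈xz∙y x′ c (k′ * c) ⟩
                  x′ + k′ * c + c       ∎)))
              where open ≋-Reasoning
            by-parity (k , inj₁ refl) (k′ , inj₂ refl) _ _ e =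
              ⊥-elim (U≢V (cong proj₁ (trans (sym (zigzag-even x k)) (trans e (zigzag-odd x′ k′)))))
            by-parity (k , inj₂ refl) (k′ , inj₁ refl) _ _ e =
              ⊥-elim (U≢V (cong proj₁ (trans (sym (zigzag-even x′ k′)) (trans (sym e) (zigzag-odd x k)))))

        block : ℕ → ℕ → Vertex m
        block r t = zigzag (toℕ (rung r)) (orient (side r) t)

        block-injective : ∀ {r r′ t t′} → r < R → r′ < R → t < order * 2 → t′ < order * 2
          → block r t ≡ block r′ t′ → r ≡ r′ × t ≡ t′
        block-injective {r} {r′} {t} {t′} r<R r′<R t<2d t′<2d e =
          let τ≡τ′ , x≋x′ = zigzag-injective (rung∈Λ r) (rung∈Λ r′) (orient-< (side r) t<2d) (orient-< (side r′) t′<2d) e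
              r≡r′ = rung-injective r<R r′<R (toℕ-≋-injective x≋x′)
          in r≡r′ , orient-injective (side r) t<2d t′<2d (trans τ≡τ′ (cong (λ r → orient (side r) t′) (sym r≡r′)))

        block-covers-zigzag : ∀ {l τ} → Λ l → τ < order * 2
          → ∃[ r ] ∃[ t ] (r < R × t < order * 2 × block r t ≡ zigzag l τ)
        block-covers-zigzag {l} {τ} l∈Λ τ<2d =
          let r , r<R , rung≡l = rung-onto l∈Λ in
          r , orient (side r) τ , r<R , orient-< (side r) τ<2d ,
          trans (cong (zigzag (toℕ (rung r))) (orient-involutive (side r) τ<2d))
                (zigzag-cong τ (≋-trans (≡⇒≋ (cong toℕ rung≡l)) (toℕ-fin l)))

        block-onto : ∀ w → ∃[ r ] ∃[ t ] (r < R × t < order * 2 × block r t ≡ w)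
        block-onto (U , i) =
          let l , j , l∈Λ , j<d , i≋l+jc = decompose (toℕ i)
              r , t , r<R , t<2d , block≡zigzag = block-covers-zigzag l∈Λ (ℕ.*-monoˡ-< 2 j<d)
          in r , t , r<R , t<2d , trans block≡zigzag (trans (zigzag-even l j) (cong (U ,_) (≋toℕ⇒fin≡ (≋-sym i≋l+jc))))
        block-onto (V , i) =
          let l , j , l∈Λ , j<d , i-c≋l+jc = decompose (toℕ i + m-1 * c)
              r , t , r<R , t<2d , block≡zigzag = block-covers-zigzag l∈Λ (ℕ.*-monoˡ-≤ 2 j<d)
          in r , t , r<R , t<2d , trans block≡zigzag (trans (zigzag-odd l j) (cong (V ,_) (≋toℕ⇒fin≡ (begin
              l + (c + j * c)           ≡⟨ x∙yz≈xz∙y l c (j * c) ⟩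
              l + j * c + c             ≈⟨ +-congʳ-≋ c i-c≋l+jc ⟨
              toℕ i + m-1 * c + c       ≡⟨ xy∙z≈xz∙y (toℕ i) (m-1 * c) c ⟩
              toℕ i + c + m-1 * c       ≈⟨ x+z+[n-1]z≋x (toℕ i) c ⟩
              toℕ i                     ∎))))
          where open ≋-Reasoning

      ladder⇒hamiltonian : Hamiltonian (RAdj m a b c)
      ladder⇒hamiltonian = hamiltonian-from-blocks R last block
        (ℕ.≤-trans (s≤s (s≤s (s≤s z≤n))) (ℕ.*-mono-≤ 2≤R (s≤s (s≤s z≤n))))
        (λ r t → orient-step (side r) (toℕ (rung r)))
        (λ r → zigzag-link (side r) (side (suc r)) (rung r) (rung (suc r)) (link r))
        (cong (λ w → zigzag (toℕ (proj₂ w)) (orient (proj₁ w) 0)) closed)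
        block-injective block-onto

proposition13 : (m a b c : ℕ) → 3 ≤ m
    → 0 < a → a < m → 0 < b → b < m → 0 < c → c < m
    → ¬ (m ∣ 2 * a) → ¬ (m ∣ 2 * b)
    → Connected (RAdj m a b c)
    → 1 < gcd (gcd m a) b
    → HasAltHamCycleH0 m a b
    → Hamiltonian (RAdj m a b c)
proposition13 (suc m-1) a b c _ _ _ _ _ _ _ _ _ conn _ (suc N-1 , f , ham , alt) =
  ladder⇒hamiltonian c conn (alternating⇒ladder N-1 f ham alt)
  where open RoseWindow m-1 a b
proposition13 (suc m-1) a b c _ _ _ _ _ _ _ _ _ _ _ (zero , _ , ham , _) with () ← IsHamCycle.length≥3 ham
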